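{- Let $n\ge1$, let $0<k<n$, let $S\subseteq[2n-1]$ with $|S|=k$, and let $0\le i\le k$. All $(n-i,\,n-k+i)$-biregular components of $O_n(S)$ are isomorphic to one another. Moreover, if $i\ne k/2$ there are exactly $\binom{k}{i}$ such components, and if $i=k/2$ there are exactly $\frac12\binom{k}{i}$ such components.
   Context: $[2n-1]=\{1,\dots,2n-1\}$. The odd graph $O_n$ has as vertices the $(n-1)$-element subsets of $[2n-1]$, with $u\sim v$ iff $u\cap v=\emptyset$; the edge $uv$ receives the colour equal to the unique element of $[2n-1]\setminus(u\cup v)$. For $S\subseteq[2n-1]$, $O_n(S)$ is the spanning subgraph of $O_n$ obtained by deleting every edge whose colour lies in $S$. A component is a maximal connected subgraph. A graph is $(a,b)$-biregular if it is bipartite with a bipartition $V=U\cup W$ such that every vertex of $U$ has degree $a$ and every vertex of $W$ has degree $b$. -}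

module Defs where

open import Data.Nat using (ℕ; _*_; _∸_)
open import Data.Fin using (Fin)
open import Data.Fin.Subset using (Subset; _∈_; _∉_; ∣_∣)
open import Data.Bool using (Bool; true; false)
open import Data.List using (List; length)
open import Data.List.Membership.Propositional using () renaming (_∈_ to _∈ᴸ_)
open import Data.List.Relation.Unary.Unique.Propositional using (Unique)
open import Data.Product using (Σ; _×_; ∃)
open import Relation.Binary.PropositionalEquality using (_≡_; _≢_)
open import Relation.Binary.Construct.Closure.ReflexiveTransitive using (Star)
open import Function.Bundles using (_⇔_)

Ground : ℕ → Set
Ground n = Fin (2 * n ∸ 1)

Sub : ℕ → Set
Sub n = Subset (2 * n ∸ 1)

IsVertex : (n : ℕ) → Sub n → Set
IsVertex n u = ∣ u ∣ ≡ n ∸ 1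

Disjoint : (n : ℕ) → Sub n → Sub n → Set
Disjoint n u v = ∀ x → x ∈ u → x ∉ v

AdjO : (n : ℕ) → Sub n → Sub n → Set
AdjO n u v = IsVertex n u × IsVertex n v × Disjoint n u v

-- c is the colour of the edge uv (the element of [2n-1] outside u ∪ v;
-- for an edge of O_n it is unique)
IsColour : (n : ℕ) → Sub n → Sub n → Ground n → Set
IsColour n u v c = c ∉ u × c ∉ v

AdjOS : (n : ℕ) → Sub n → Sub n → Sub n → Set
AdjOS n S u v = AdjO n u v × (∀ c → IsColour n u v c → c ∉ S)

module Graph {V : Set} (Vx : V → Set) (E : V → V → Set) where

  InComp : V → V → Set
  InComp r w = Vx w × Star E r w

  HasDegree : V → ℕ → Set
  HasDegree v d = Σ (List V) λ L → length L ≡ d × Unique L × (∀ w → (w ∈ᴸ L) ⇔ E v w)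

  BiregularComp : ℕ → ℕ → V → Set
  BiregularComp a b r =
    Σ (V → Bool) λ side →
      (∀ w w' → InComp r w → InComp r w' → E w w' → side w ≢ side w') ×
      (∀ w → InComp r w → side w ≡ true → HasDegree w a) ×
      (∀ w → InComp r w → side w ≡ false → HasDegree w b)

  IsoComp : V → V → Set
  IsoComp r₁ r₂ =
    Σ (V → V) λ f → Σ (V → V) λ g →
      (∀ w → InComp r₁ w → InComp r₂ (f w)) ×
      (∀ w → InComp r₂ w → InComp r₁ (g w)) ×
      (∀ w → InComp r₁ w → g (f w) ≡ w) ×
      (∀ w → InComp r₂ w → f (g w) ≡ w) ×
      (∀ w w' → InComp r₁ w → InComp r₁ w' → E w w' ⇔ E (f w) (f w'))

  -- there are exactly N components whose property is P (P given on
  -- a representative vertex): N representatives in pairwise distinct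
  -- components, each satisfying P, and every vertex satisfying P lies in
  -- the component of one of them
  ExactlyComps : (V → Set) → ℕ → Set
  ExactlyComps P N =
    Σ (Fin N → V) λ rep →
      (∀ j → Vx (rep j) × P (rep j)) ×
      (∀ j j' → Star E (rep j) (rep j') → j ≡ j') ×
      (∀ w → Vx w → P w → ∃ λ j → Star E (rep j) w)

module Submission where

-- Call u ∩ S the trace of a vertex u.
-- An edge at u of colour c ∉ S leads to the complement of u minus c, so
-- crossing an edge turns the trace B into S ─ B, and u has n - k + ∣ u ∩ S ∣
-- free colours, i.e. neighbours.  Conversely two vertices with equal traces
-- are joined by a walk (trade one element outside S for another, two edges
-- at a time).  So the components are exactly the classes of vertices with
-- trace B or S ─ B; each is bipartite with degrees n - k + ∣ B ∣ and
-- n - k + ∣ S ─ B ∣, and the (n - i, n - k + i)-biregular ones are the classes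
-- with ∣ B ∣ = i.  Two such classes are isomorphic by retracing (keep u ─ S,
-- send trace B₁ to B₂ and S ─ B₁ to S ─ B₂).  They are counted by a list of
-- i-subsets of S holding one set of each pair {B, S ─ B}: all i-subsets if
-- 2i ≠ k, and those containing the least element of S if 2i = k.

open import Defs
open import Data.Nat using (ℕ; zero; suc; _*_; _≤_; _<_; _∸_; _+_; z≤n; s≤s; pred; ≢-nonZero)
open import Data.Nat.Properties
open import Data.Nat.Combinatorics using (_C_; nCk≡nC[n∸k]; nCk+nC[k+1]≡[n+1]C[k+1])
open import Data.Nat.Tactic.RingSolver using (solve-∀)
open import Data.Bool using (Bool; true; false; not; _∧_; _∨_; if_then_else_)
open import Data.Bool.Properties
  using (∧-conicalˡ; ∧-conicalʳ; ∧-zeroʳ; ∧-identityʳ; ∨-identityʳ; not-involutive; not-injective; not-¬)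
  renaming (_≟_ to _≟ᵇ_)
open import Data.Fin using (Fin; zero; suc)
open import Data.Fin.Properties using () renaming (_≟_ to _≟ᶠ_; suc-injective to fsuc-injective)
open import Data.Fin.Subset using (Subset; ∣_∣; ∁; _∩_; _∪_; _─_)
  renaming (_∈_ to _∈ₛ_; _∉_ to _∉ₛ_)
open import Data.Fin.Subset.Properties using (∣∁p∣≡n∸∣p∣; ∣p∣≤n; p⊆q⇒∣p∣≤∣q∣; ∩-comm)
open import Data.Vec using ([]; _∷_; lookup; _[_]≔_)
open import Data.Vec.Properties
  using ([]=⇒lookup; lookup⇒[]=; lookup∘update; lookup∘update′; lookup-map; lookup-zipWith; ∷-injectiveʳ)
  renaming (≡-dec to Vec-≡-dec)
open import Data.List using (List; []; _∷_; length; map; _++_)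
import Data.List as List
open import Data.List.Properties using (length-map; length-++)
open import Data.List.Membership.Propositional using () renaming (_∈_ to _∈ᴸ_)
open import Data.List.Membership.Propositional.Properties
  using (∈-map⁺; ∈-map⁻; ∈-++⁺ˡ; ∈-++⁺ʳ; ∈-++⁻; ∈-lookup)
open import Data.List.Relation.Unary.Any using (here; there; index)
open import Data.List.Relation.Unary.Any.Properties using (lookup-index)
open import Data.List.Relation.Unary.All using ([]; _∷_)
import Data.List.Relation.Unary.All as All
open import Data.List.Relation.Unary.All.Properties using () renaming (map⁺ to All-map⁺)
open import Data.List.Relation.Unary.AllPairs using ([]; _∷_)
open import Data.List.Relation.Unary.Unique.Propositional using (Unique)
import Data.List.Relation.Unary.Unique.Propositional.Properties as Unique
open import Data.Product using (Σ; _×_; ∃; _,_; proj₁; proj₂)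
open import Data.Sum using (_⊎_; inj₁; inj₂)
open import Data.Empty using (⊥; ⊥-elim)
open import Relation.Nullary using (Dec; yes; no; does)
open import Relation.Binary.PropositionalEquality
open import Relation.Binary.Construct.Closure.ReflexiveTransitive using (Star; ε; _◅_; _◅◅_)
open import Function.Base using (_∘_)
open import Function.Bundles using (_⇔_; mk⇔; Equivalence)

-- Subsets of Fin m are Boolean vectors; we reason about them pointwise,
-- through the Boolean u ! x saying whether x ∈ u.

infixl 9 _!_
_!_ : ∀ {m} → Subset m → Fin m → Bool
v ! x = lookup v x

infix 4 _⊑_
_⊑_ : ∀ {m} → Subset m → Subset m → Set
u ⊑ v = ∀ x → u ! x ≡ true → v ! x ≡ true

⊑-∷ : ∀ {m} {a b} {B x : Subset m} → (b ≡ true → a ≡ true) → B ⊑ x → (b ∷ B) ⊑ (a ∷ x)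
⊑-∷ head _ zero e = head e
⊑-∷ _ B⊑x (suc p) e = B⊑x p e

⊑-tail : ∀ {m} {a b} {B x : Subset m} → (b ∷ B) ⊑ (a ∷ x) → B ⊑ x
⊑-tail h p = h (suc p)

subset-ext : ∀ {m} {u v : Subset m} → (∀ x → u ! x ≡ v ! x) → u ≡ v
subset-ext {u = []} {[]} h = refl
subset-ext {u = a ∷ u} {b ∷ v} h = cong₂ _∷_ (h zero) (subset-ext (λ x → h (suc x)))

∈⇒! : ∀ {m} {x : Fin m} {v} → x ∈ₛ v → v ! x ≡ true
∈⇒! = []=⇒lookup

!⇒∈ : ∀ {m} {x : Fin m} {v} → v ! x ≡ true → x ∈ₛ v
!⇒∈ {x = x} {v} = lookup⇒[]= x v

∉⇒! : ∀ {m} {x : Fin m} {v} → x ∉ₛ v → v ! x ≡ false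
∉⇒! {x = x} {v} x∉v with v ! x in e
... | true = ⊥-elim (x∉v (!⇒∈ e))
... | false = refl

!⇒∉ : ∀ {m} {x : Fin m} {v} → v ! x ≡ false → x ∉ₛ v
!⇒∉ e x∈v = not-¬ (∈⇒! x∈v) e

not≡true : ∀ {b} → not b ≡ true → b ≡ false
not≡true {b} e = not-injective {b} {false} e

!-∁ : ∀ {m} (v : Subset m) x → ∁ v ! x ≡ not (v ! x)
!-∁ v x = lookup-map x not v

!-∩ : ∀ {m} (u v : Subset m) x → (u ∩ v) ! x ≡ u ! x ∧ v ! x
!-∩ u v x = lookup-zipWith _∧_ x u v

!-∪ : ∀ {m} (u v : Subset m) x → (u ∪ v) ! x ≡ u ! x ∨ v ! x
!-∪ u v x = lookup-zipWith _∨_ x u v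

!-─ : ∀ {m} (u v : Subset m) x → (u ─ v) ! x ≡ u ! x ∧ not (v ! x)
!-─ (a ∷ u) (true ∷ v) zero = sym (∧-zeroʳ a)
!-─ (a ∷ u) (false ∷ v) zero = sym (∧-identityʳ a)
!-─ (a ∷ u) (b ∷ v) (suc x) = !-─ u v x

!-≔-same : ∀ {m} (v : Subset m) x b → (v [ x ]≔ b) ! x ≡ b
!-≔-same v x b = lookup∘update x v b

!-≔-other : ∀ {m} (v : Subset m) {x y} b → x ≢ y → (v [ x ]≔ b) ! y ≡ v ! y
!-≔-other v b x≢y = lookup∘update′ (λ e → x≢y (sym e)) v b

⊑-∣∣-≤ : ∀ {m} {u v : Subset m} → u ⊑ v → ∣ u ∣ ≤ ∣ v ∣
⊑-∣∣-≤ {u = u} {v} u⊑v = p⊆q⇒∣p∣≤∣q∣ {p = u} {q = v} (λ {x} x∈u → !⇒∈ {v = v} (u⊑v x (∈⇒! x∈u)))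

⊑-equal-size : ∀ {m} {w v : Subset m} → w ⊑ v → ∣ w ∣ ≡ ∣ v ∣ → w ≡ v
⊑-equal-size {w = []} {[]} _ _ = refl
⊑-equal-size {w = true ∷ w} {true ∷ v} w⊑v e =
  cong (true ∷_) (⊑-equal-size (⊑-tail w⊑v) (suc-injective e))
⊑-equal-size {w = false ∷ w} {false ∷ v} w⊑v e =
  cong (false ∷_) (⊑-equal-size (⊑-tail w⊑v) e)
⊑-equal-size {w = true ∷ w} {false ∷ v} w⊑v e with w⊑v zero refl
... | ()
⊑-equal-size {w = false ∷ w} {true ∷ v} w⊑v e =
  ⊥-elim (<⇒≱ (s≤s ≤-refl) (≤-trans (≤-reflexive (sym e)) (⊑-∣∣-≤ {u = w} {v} (⊑-tail w⊑v))))

remove-one : ∀ {m} {w v : Subset m} → w ⊑ v → suc ∣ w ∣ ≡ ∣ v ∣ →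
  ∃ λ c → v ! c ≡ true × w ≡ v [ c ]≔ false
remove-one {w = true ∷ w} {true ∷ v} w⊑v e
  with c , vc , eq ← remove-one (⊑-tail w⊑v) (suc-injective e) =
  suc c , vc , cong (true ∷_) eq
remove-one {w = false ∷ w} {false ∷ v} w⊑v e
  with c , vc , eq ← remove-one (⊑-tail w⊑v) e =
  suc c , vc , cong (false ∷_) eq
remove-one {w = false ∷ w} {true ∷ v} w⊑v e =
  zero , refl , cong (false ∷_) (⊑-equal-size (⊑-tail w⊑v) (suc-injective e))
remove-one {w = true ∷ w} {false ∷ v} w⊑v e with w⊑v zero refl
... | ()

∣∣-remove : ∀ {m} (v : Subset m) x → v ! x ≡ true → suc ∣ v [ x ]≔ false ∣ ≡ ∣ v ∣
∣∣-remove (true ∷ v) zero e = refl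
∣∣-remove (true ∷ v) (suc x) e = cong suc (∣∣-remove v x e)
∣∣-remove (false ∷ v) (suc x) e = ∣∣-remove v x e

nonempty : ∀ {m} (v : Subset m) → 0 < ∣ v ∣ → ∃ λ x → v ! x ≡ true
nonempty (true ∷ v) _ = zero , refl
nonempty (false ∷ v) p with x , e ← nonempty v p = suc x , e

member⇒nonzero : ∀ {m} (v : Subset m) x → v ! x ≡ true → 0 < ∣ v ∣
member⇒nonzero (true ∷ v) x e = s≤s z≤n
member⇒nonzero (false ∷ v) (suc x) e = member⇒nonzero v x e

subset-of-size : ∀ {m} (x : Subset m) j → j ≤ ∣ x ∣ → ∃ λ y → y ⊑ x × ∣ y ∣ ≡ j
subset-of-size [] zero _ = [] , (λ ()) , refl
subset-of-size (false ∷ x) j j≤ with y , y⊑x , ∣y∣ ← subset-of-size x j j≤ =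
  false ∷ y , ⊑-∷ (λ ()) y⊑x , ∣y∣
subset-of-size (true ∷ x) zero _ with y , y⊑x , ∣y∣ ← subset-of-size x zero z≤n =
  false ∷ y , ⊑-∷ (λ ()) y⊑x , ∣y∣
subset-of-size (true ∷ x) (suc j) (s≤s j≤) with y , y⊑x , ∣y∣ ← subset-of-size x j j≤ =
  true ∷ y , ⊑-∷ (λ _ → refl) y⊑x , cong suc ∣y∣

∣∣-∁ : ∀ {m} (v : Subset m) → ∣ v ∣ + ∣ ∁ v ∣ ≡ m
∣∣-∁ v = trans (cong (∣ v ∣ +_) (∣∁p∣≡n∸∣p∣ v)) (m+[n∸m]≡n (∣p∣≤n v))

∣∣-split : ∀ {m} (v S : Subset m) → ∣ v ∣ ≡ ∣ v ∩ S ∣ + ∣ v ─ S ∣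
∣∣-split [] [] = refl
∣∣-split (true ∷ v) (true ∷ S) = cong suc (∣∣-split v S)
∣∣-split (true ∷ v) (false ∷ S) = trans (cong suc (∣∣-split v S)) (sym (+-suc _ _))
∣∣-split (false ∷ v) (true ∷ S) = ∣∣-split v S
∣∣-split (false ∷ v) (false ∷ S) = ∣∣-split v S

∣─∣-sym : ∀ {m} (u v : Subset m) → ∣ u ∣ ≡ ∣ v ∣ → ∣ u ─ v ∣ ≡ ∣ v ─ u ∣
∣─∣-sym u v e = +-cancelˡ-≡ ∣ u ∩ v ∣ _ _ (begin
  ∣ u ∩ v ∣ + ∣ u ─ v ∣ ≡⟨ sym (∣∣-split u v) ⟩
  ∣ u ∣                 ≡⟨ e ⟩
  ∣ v ∣                 ≡⟨ ∣∣-split v u ⟩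
  ∣ v ∩ u ∣ + ∣ v ─ u ∣ ≡⟨ cong (λ z → ∣ z ∣ + ∣ v ─ u ∣) (∩-comm v u) ⟩
  ∣ u ∩ v ∣ + ∣ v ─ u ∣ ∎)
  where open ≡-Reasoning

∣∣-outside-both : ∀ {m} (u S : Subset m) → ∣ ∁ u ─ S ∣ + ∣ u ∣ + ∣ S ∣ ≡ m + ∣ u ∩ S ∣
∣∣-outside-both [] [] = refl
∣∣-outside-both {suc m} (true ∷ u) (true ∷ S) = begin
  ∣ ∁ u ─ S ∣ + suc ∣ u ∣ + suc ∣ S ∣   ≡⟨ shift₂ _ _ _ ⟩
  suc (suc (∣ ∁ u ─ S ∣ + ∣ u ∣ + ∣ S ∣)) ≡⟨ cong (λ z → suc (suc z)) (∣∣-outside-both u S) ⟩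
  suc (suc (m + ∣ u ∩ S ∣))             ≡⟨ cong suc (sym (+-suc m ∣ u ∩ S ∣)) ⟩
  suc (m + suc ∣ u ∩ S ∣)               ∎
  where
  open ≡-Reasoning
  shift₂ : ∀ x a b → x + suc a + suc b ≡ suc (suc (x + a + b))
  shift₂ = solve-∀
∣∣-outside-both {suc m} (true ∷ u) (false ∷ S) =
  trans (cong (_+ ∣ S ∣) (+-suc _ ∣ u ∣)) (cong suc (∣∣-outside-both u S))
∣∣-outside-both {suc m} (false ∷ u) (true ∷ S) =
  trans (+-suc _ ∣ S ∣) (cong suc (∣∣-outside-both u S))
∣∣-outside-both {suc m} (false ∷ u) (false ∷ S) = cong suc (∣∣-outside-both u S)

map-Unique : ∀ {A B : Set} (f : A → B) {xs : List A} → Unique xs →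
  (∀ {x y} → x ∈ᴸ xs → y ∈ᴸ xs → f x ≡ f y → x ≡ y) → Unique (map f xs)
map-Unique f {[]} [] inj = []
map-Unique f {x ∷ xs} (x∉xs ∷ u) inj =
  All-map⁺ (All.tabulate (λ {y} y∈xs fx≡fy →
      All.lookup x∉xs y∈xs (inj (here refl) (there y∈xs) fx≡fy)))
  ∷ map-Unique f u (λ p q → inj (there p) (there q))

private
  delete : ∀ {A : Set} {x : A} (ys : List A) → x ∈ᴸ ys → List A
  delete (y ∷ ys) (here _) = ys
  delete (y ∷ ys) (there p) = y ∷ delete ys p

  length-delete : ∀ {A : Set} {x : A} (ys : List A) (p : x ∈ᴸ ys) →
    suc (length (delete ys p)) ≡ length ys
  length-delete (y ∷ ys) (here _) = refl
  length-delete (y ∷ ys) (there p) = cong suc (length-delete ys p)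

  ∈-delete : ∀ {A : Set} {x z : A} (ys : List A) (p : x ∈ᴸ ys) →
    z ∈ᴸ ys → x ≢ z → z ∈ᴸ delete ys p
  ∈-delete (y ∷ ys) (here refl) (here refl) x≢z = ⊥-elim (x≢z refl)
  ∈-delete (y ∷ ys) (here refl) (there q) x≢z = q
  ∈-delete (y ∷ ys) (there p) (here e) x≢z = here e
  ∈-delete (y ∷ ys) (there p) (there q) x≢z = there (∈-delete ys p q x≢z)

Unique-length-≤ : ∀ {A : Set} (xs ys : List A) → Unique xs →
  (∀ z → z ∈ᴸ xs → z ∈ᴸ ys) → length xs ≤ length ys
Unique-length-≤ [] ys _ _ = z≤n
Unique-length-≤ (x ∷ xs) ys (x∉xs ∷ u) xs⊆ys =
  subst (suc (length xs) ≤_) (length-delete ys x∈ys)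
    (s≤s (Unique-length-≤ xs (delete ys x∈ys) u
      (λ z z∈xs → ∈-delete ys x∈ys (xs⊆ys z (there z∈xs)) (All.lookup x∉xs z∈xs))))
  where x∈ys = xs⊆ys x (here refl)

Unique-length : ∀ {A : Set} (xs ys : List A) → Unique xs → Unique ys →
  (∀ z → z ∈ᴸ xs ⇔ z ∈ᴸ ys) → length xs ≡ length ys
Unique-length xs ys u v same = ≤-antisym
  (Unique-length-≤ xs ys u (λ z → Equivalence.to (same z)))
  (Unique-length-≤ ys xs v (λ z → Equivalence.from (same z)))

lookup-injective : ∀ {A : Set} (xs : List A) → Unique xs →
  ∀ j j' → List.lookup xs j ≡ List.lookup xs j' → j ≡ j'
lookup-injective (x ∷ xs) (x∉xs ∷ u) zero zero e = refl
lookup-injective (x ∷ xs) (x∉xs ∷ u) zero (suc j') e =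
  ⊥-elim (All.lookup x∉xs (∈-lookup j') e)
lookup-injective (x ∷ xs) (x∉xs ∷ u) (suc j) zero e =
  ⊥-elim (All.lookup x∉xs (∈-lookup j) (sym e))
lookup-injective (x ∷ xs) (x∉xs ∷ u) (suc j) (suc j') e =
  cong suc (lookup-injective xs u j j' e)

members : ∀ {m} → Subset m → List (Fin m)
members [] = []
members (true ∷ v) = zero ∷ map suc (members v)
members (false ∷ v) = map suc (members v)

length-members : ∀ {m} (v : Subset m) → length (members v) ≡ ∣ v ∣
length-members [] = refl
length-members (true ∷ v) = cong suc (trans (length-map suc (members v)) (length-members v))
length-members (false ∷ v) = trans (length-map suc (members v)) (length-members v)

∈-members : ∀ {m} (v : Subset m) x → x ∈ᴸ members v ⇔ v ! x ≡ true
∈-members v x = mk⇔ (to v x) (from v x)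
  where
  to : ∀ {m} (v : Subset m) x → x ∈ᴸ members v → v ! x ≡ true
  to (true ∷ v) zero _ = refl
  to (true ∷ v) (suc x) (there p) with y , q , refl ← ∈-map⁻ suc p = to v y q
  to (false ∷ v) x p with y , q , refl ← ∈-map⁻ suc p = to v y q
  from : ∀ {m} (v : Subset m) x → v ! x ≡ true → x ∈ᴸ members v
  from (true ∷ v) zero _ = here refl
  from (true ∷ v) (suc x) e = there (∈-map⁺ suc (from v x e))
  from (false ∷ v) (suc x) e = ∈-map⁺ suc (from v x e)

Unique-members : ∀ {m} (v : Subset m) → Unique (members v)
Unique-members [] = []
Unique-members (true ∷ v) =
  All.tabulate (λ p → case-suc (∈-map⁻ suc p)) ∷ Unique.map⁺ fsuc-injective (Unique-members v)
  where
  case-suc : ∀ {m} {x : Fin (suc m)} {l} → ∃ (λ y → y ∈ᴸ l × x ≡ suc y) → zero ≢ x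
  case-suc (y , _ , refl) ()
Unique-members (false ∷ v) = Unique.map⁺ fsuc-injective (Unique-members v)

subsets : ∀ {m} → Subset m → ℕ → List (Subset m)
subsets [] zero = [] ∷ []
subsets [] (suc j) = []
subsets (false ∷ x) j = map (false ∷_) (subsets x j)
subsets (true ∷ x) zero = map (false ∷_) (subsets x zero)
subsets (true ∷ x) (suc j) = map (true ∷_) (subsets x j) ++ map (false ∷_) (subsets x (suc j))

subsets-sound : ∀ {m} (x : Subset m) j B → B ∈ᴸ subsets x j → B ⊑ x × ∣ B ∣ ≡ j
subsets-sound [] zero .[] (here refl) = (λ ()) , refl
subsets-sound (false ∷ x) j B p with B' , q , refl ← ∈-map⁻ (false ∷_) p =
  let (B'⊑x , ∣B'∣) = subsets-sound x j B' q in ⊑-∷ (λ ()) B'⊑x , ∣B'∣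
subsets-sound (true ∷ x) zero B p with B' , q , refl ← ∈-map⁻ (false ∷_) p =
  let (B'⊑x , ∣B'∣) = subsets-sound x zero B' q in ⊑-∷ (λ ()) B'⊑x , ∣B'∣
subsets-sound (true ∷ x) (suc j) B p with ∈-++⁻ (map (true ∷_) (subsets x j)) p
... | inj₁ p' with B' , q , refl ← ∈-map⁻ (true ∷_) p' =
  let (B'⊑x , ∣B'∣) = subsets-sound x j B' q in ⊑-∷ (λ _ → refl) B'⊑x , cong suc ∣B'∣
... | inj₂ p' with B' , q , refl ← ∈-map⁻ (false ∷_) p' =
  let (B'⊑x , ∣B'∣) = subsets-sound x (suc j) B' q in ⊑-∷ (λ ()) B'⊑x , ∣B'∣

subsets-complete : ∀ {m} (x B : Subset m) → B ⊑ x → B ∈ᴸ subsets x ∣ B ∣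
subsets-complete [] [] _ = here refl
subsets-complete (false ∷ x) (false ∷ B) h = ∈-map⁺ (false ∷_) (subsets-complete x B (⊑-tail h))
subsets-complete (true ∷ x) (true ∷ B) h = ∈-++⁺ˡ (∈-map⁺ (true ∷_) (subsets-complete x B (⊑-tail h)))
subsets-complete (true ∷ x) (false ∷ B) h with ∣ B ∣ | subsets-complete x B (⊑-tail h)
... | zero | q = ∈-map⁺ (false ∷_) q
... | suc j | q = ∈-++⁺ʳ (map (true ∷_) (subsets x j)) (∈-map⁺ (false ∷_) q)
subsets-complete (false ∷ x) (true ∷ B) h with h zero refl
... | ()

subsets-unique : ∀ {m} (x : Subset m) j → Unique (subsets x j)
subsets-unique [] zero = [] ∷ []
subsets-unique [] (suc j) = []
subsets-unique (false ∷ x) j = Unique.map⁺ ∷-injectiveʳ (subsets-unique x j)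
subsets-unique (true ∷ x) zero = Unique.map⁺ ∷-injectiveʳ (subsets-unique x zero)
subsets-unique (true ∷ x) (suc j) =
  Unique.++⁺ (Unique.map⁺ ∷-injectiveʳ (subsets-unique x j))
             (Unique.map⁺ ∷-injectiveʳ (subsets-unique x (suc j)))
             (λ (p , q) → distinct-heads (∈-map⁻ (true ∷_) p) (∈-map⁻ (false ∷_) q))
  where
  distinct-heads : ∀ {m} {B : Subset (suc m)} {l l'} →
    ∃ (λ B' → B' ∈ᴸ l × B ≡ true ∷ B') → ∃ (λ B' → B' ∈ᴸ l' × B ≡ false ∷ B') → ⊥
  distinct-heads (_ , _ , refl) (_ , _ , ())

-- Pascal's rule makes the enumeration of size ∣ x ∣ C j.
length-subsets : ∀ {m} (x : Subset m) j → length (subsets x j) ≡ ∣ x ∣ C j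
length-subsets [] zero = refl
length-subsets [] (suc j) = refl
length-subsets (false ∷ x) j = trans (length-map _ (subsets x j)) (length-subsets x j)
length-subsets (true ∷ x) zero = trans (length-map _ (subsets x zero)) (length-subsets x zero)
length-subsets (true ∷ x) (suc j) = begin
  length (map (true ∷_) (subsets x j) ++ map (false ∷_) (subsets x (suc j)))
    ≡⟨ length-++ (map (true ∷_) (subsets x j)) ⟩
  length (map (true ∷_) (subsets x j)) + length (map (false ∷_) (subsets x (suc j)))
    ≡⟨ cong₂ _+_ (length-map _ (subsets x j)) (length-map _ (subsets x (suc j))) ⟩
  length (subsets x j) + length (subsets x (suc j))
    ≡⟨ cong₂ _+_ (length-subsets x j) (length-subsets x (suc j)) ⟩
  ∣ x ∣ C j + ∣ x ∣ C suc j
    ≡⟨ nCk+nC[k+1]≡[n+1]C[k+1] ∣ x ∣ j ⟩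
  suc ∣ x ∣ C suc j ∎
  where open ≡-Reasoning

-- Enumerating the j-element subsets of x that contain the least element of x.
-- For j = 2i and ∣ x ∣ = 2i they pick one set out of each pair {B, x ─ B}.

ContainsLeast : ∀ {m} → Subset m → Subset m → Set
ContainsLeast [] [] = ⊥
ContainsLeast (false ∷ x) (b ∷ B) = ContainsLeast x B
ContainsLeast (true ∷ x) (b ∷ B) = b ≡ true

subsetsWithLeast : ∀ {m} → Subset m → ℕ → List (Subset m)
subsetsWithLeast [] j = []
subsetsWithLeast (false ∷ x) j = map (false ∷_) (subsetsWithLeast x j)
subsetsWithLeast (true ∷ x) zero = []
subsetsWithLeast (true ∷ x) (suc j) = map (true ∷_) (subsets x j)

subsetsWithLeast-sound : ∀ {m} (x : Subset m) j B → B ∈ᴸ subsetsWithLeast x j →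
  B ⊑ x × ∣ B ∣ ≡ j × ContainsLeast x B
subsetsWithLeast-sound (false ∷ x) j B p with B' , q , refl ← ∈-map⁻ (false ∷_) p =
  let (B'⊑x , ∣B'∣ , least) = subsetsWithLeast-sound x j B' q in ⊑-∷ (λ ()) B'⊑x , ∣B'∣ , least
subsetsWithLeast-sound (true ∷ x) (suc j) B p with B' , q , refl ← ∈-map⁻ (true ∷_) p =
  let (B'⊑x , ∣B'∣) = subsets-sound x j B' q in ⊑-∷ (λ _ → refl) B'⊑x , cong suc ∣B'∣ , refl

subsetsWithLeast-complete : ∀ {m} (x B : Subset m) → B ⊑ x → ContainsLeast x B →
  B ∈ᴸ subsetsWithLeast x ∣ B ∣
subsetsWithLeast-complete [] [] _ ()
subsetsWithLeast-complete (false ∷ x) (false ∷ B) h least =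
  ∈-map⁺ (false ∷_) (subsetsWithLeast-complete x B (⊑-tail h) least)
subsetsWithLeast-complete (false ∷ x) (true ∷ B) h least with h zero refl
... | ()
subsetsWithLeast-complete (true ∷ x) (true ∷ B) h refl =
  ∈-map⁺ (true ∷_) (subsets-complete x B (⊑-tail h))

subsetsWithLeast-unique : ∀ {m} (x : Subset m) j → Unique (subsetsWithLeast x j)
subsetsWithLeast-unique [] j = []
subsetsWithLeast-unique (false ∷ x) j = Unique.map⁺ ∷-injectiveʳ (subsetsWithLeast-unique x j)
subsetsWithLeast-unique (true ∷ x) zero = []
subsetsWithLeast-unique (true ∷ x) (suc j) = Unique.map⁺ ∷-injectiveʳ (subsets-unique x j)

length-subsetsWithLeast : ∀ {m} (x : Subset m) j → 0 < ∣ x ∣ →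
  length (subsetsWithLeast x (suc j)) ≡ pred ∣ x ∣ C j
length-subsetsWithLeast (false ∷ x) j x≢∅ =
  trans (length-map _ (subsetsWithLeast x (suc j))) (length-subsetsWithLeast x j x≢∅)
length-subsetsWithLeast (true ∷ x) j _ = trans (length-map _ (subsets x j)) (length-subsets x j)

least-in-one : ∀ {m} (x B : Subset m) → 0 < ∣ x ∣ → ContainsLeast x B ⊎ ContainsLeast x (x ─ B)
least-in-one (false ∷ x) (b ∷ B) x≢∅ = least-in-one x B x≢∅
least-in-one (true ∷ x) (true ∷ B) _ = inj₁ refl
least-in-one (true ∷ x) (false ∷ B) _ = inj₂ refl

least-not-in-both : ∀ {m} (x B : Subset m) → ContainsLeast x B → ContainsLeast x (x ─ B) → ⊥
least-not-in-both [] [] ()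
least-not-in-both (false ∷ x) (true ∷ B) inB inRest = least-not-in-both x B inB inRest
least-not-in-both (false ∷ x) (false ∷ B) inB inRest = least-not-in-both x B inB inRest
least-not-in-both (true ∷ x) (true ∷ B) _ ()
least-not-in-both (true ∷ x) (false ∷ B) () _

central-binomial : ∀ j → 2 * ((2 * suc j ∸ 1) C j) ≡ (2 * suc j) C suc j
central-binomial j = begin
  2 * (N C j)         ≡⟨ cong (N C j +_) (+-identityʳ (N C j)) ⟩
  N C j + N C j       ≡⟨ cong (N C j +_) symmetric ⟩
  N C j + N C suc j   ≡⟨ nCk+nC[k+1]≡[n+1]C[k+1] N j ⟩
  suc N C suc j       ∎
  where
  open ≡-Reasoning
  N = 2 * suc j ∸ 1
  symmetric : N C j ≡ N C suc j
  symmetric = trans (nCk≡nC[n∸k] (m≤m+n j _))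
                (cong (N C_) (trans (m+n∸m≡n j (suc (j + 0))) (cong suc (+-identityʳ j))))

length-subsetsWithLeast-half : ∀ {m} (x : Subset m) j → ∣ x ∣ ≡ 2 * suc j →
  2 * length (subsetsWithLeast x (suc j)) ≡ ∣ x ∣ C suc j
length-subsetsWithLeast-half x j ∣x∣ = begin
  2 * length (subsetsWithLeast x (suc j)) ≡⟨ cong (2 *_) (length-subsetsWithLeast x j x≢∅) ⟩
  2 * (pred ∣ x ∣ C j)                     ≡⟨ cong (λ z → 2 * (pred z C j)) ∣x∣ ⟩
  2 * ((2 * suc j ∸ 1) C j)                ≡⟨ central-binomial j ⟩
  (2 * suc j) C suc j                      ≡⟨ cong (_C suc j) (sym ∣x∣) ⟩
  ∣ x ∣ C suc j                            ∎
  where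
  open ≡-Reasoning
  x≢∅ : 0 < ∣ x ∣
  x≢∅ = subst (0 <_) (sym ∣x∣) (s≤s z≤n)

module RelativeComplement {m} (S : Subset m) where

  ⊑-∩ : ∀ B → B ⊑ S → S ∩ B ≡ B
  ⊑-∩ B B⊑S = subset-ext λ x → trans (!-∩ S B x) (pointwise x)
    where
    pointwise : ∀ x → S ! x ∧ B ! x ≡ B ! x
    pointwise x with B ! x in bx
    ... | true = trans (cong (_∧ true) (B⊑S x bx)) refl
    ... | false = ∧-zeroʳ (S ! x)

  ─-⊑ : ∀ B → S ─ B ⊑ S
  ─-⊑ B x e = ∧-conicalˡ _ _ (trans (sym (!-─ S B x)) e)

  ─-involutive : ∀ B → B ⊑ S → S ─ (S ─ B) ≡ B
  ─-involutive B B⊑S = subset-ext λ x →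
    trans (!-─ S (S ─ B) x) (trans (cong (λ z → S ! x ∧ not z) (!-─ S B x)) (pointwise x))
    where
    pointwise : ∀ x → S ! x ∧ not (S ! x ∧ not (B ! x)) ≡ B ! x
    pointwise x with B ! x in bx
    ... | true = cong (λ s → s ∧ not (s ∧ false)) (B⊑S x bx)
    ... | false with S ! x
    ...   | true = refl
    ...   | false = refl

  ∣─∣ : ∀ B → B ⊑ S → ∣ S ─ B ∣ ≡ ∣ S ∣ ∸ ∣ B ∣
  ∣─∣ B B⊑S = sym (begin
    ∣ S ∣ ∸ ∣ B ∣                       ≡⟨ cong (_∸ ∣ B ∣) (∣∣-split S B) ⟩
    ∣ S ∩ B ∣ + ∣ S ─ B ∣ ∸ ∣ B ∣       ≡⟨ cong (λ z → ∣ z ∣ + ∣ S ─ B ∣ ∸ ∣ B ∣) (⊑-∩ B B⊑S) ⟩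
    ∣ B ∣ + ∣ S ─ B ∣ ∸ ∣ B ∣           ≡⟨ m+n∸m≡n ∣ B ∣ ∣ S ─ B ∣ ⟩
    ∣ S ─ B ∣                           ∎)
    where open ≡-Reasoning

  ─-no-fixpoint : 0 < ∣ S ∣ → ∀ B → B ≢ S ─ B
  ─-no-fixpoint S≢∅ B B≡S─B with s , Ss ← nonempty S S≢∅ =
    not-¬ refl (trans (cong (_! s) B≡S─B) (trans (!-─ S B s) (cong (_∧ not (B ! s)) Ss)))

-- The graph O_n(S), written with n = suc n'.  Vertices are the n'-subsets
-- of the ground set of size n' + n; the edges at u are u ↦ across u c for
-- the colours c outside both u and S.

module ColouredOddGraph (n' : ℕ) (S : Sub (suc n')) where

  n : ℕ
  n = suc n'

  V : Set
  V = Sub n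

  Vx : V → Set
  Vx = IsVertex n

  E : V → V → Set
  E = AdjOS n S

  open Graph Vx E public

  ground-size : 2 * n ∸ 1 ≡ n' + n
  ground-size = cong (n' +_) (cong suc (+-identityʳ n'))

  across : V → Ground n → V
  across u c = ∁ u [ c ]≔ false

  free : V → V
  free u = ∁ u ─ S

  -- The part of u inside S; the edges of O_n(S) complement it within S.
  trace : V → V
  trace u = u ∩ S

  !-across : ∀ u {c x} → c ≢ x → across u c ! x ≡ not (u ! x)
  !-across u {c} {x} c≢x = trans (!-≔-other (∁ u) false c≢x) (!-∁ u x)

  !-free : ∀ u c → free u ! c ≡ not (u ! c) ∧ not (S ! c)
  !-free u c = trans (!-─ (∁ u) S c) (cong (_∧ not (S ! c)) (!-∁ u c))

  free⇒ : ∀ u c → free u ! c ≡ true → u ! c ≡ false × S ! c ≡ false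
  free⇒ u c e = not≡true (∧-conicalˡ _ _ e') , not≡true (∧-conicalʳ _ _ e')
    where e' = trans (sym (!-free u c)) e

  ⇒free : ∀ u c → u ! c ≡ false → S ! c ≡ false → free u ! c ≡ true
  ⇒free u c uc sc = trans (!-free u c) (cong₂ (λ a b → not a ∧ not b) uc sc)

  ∣∁∣-vertex : ∀ u → Vx u → ∣ ∁ u ∣ ≡ n
  ∣∁∣-vertex u u∈V = +-cancelˡ-≡ n' _ _ (begin
    n' + ∣ ∁ u ∣    ≡⟨ cong (_+ ∣ ∁ u ∣) (sym u∈V) ⟩
    ∣ u ∣ + ∣ ∁ u ∣ ≡⟨ ∣∣-∁ u ⟩
    2 * n ∸ 1       ≡⟨ ground-size ⟩
    n' + n          ∎)
    where open ≡-Reasoning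

  across-vertex : ∀ u c → Vx u → u ! c ≡ false → Vx (across u c)
  across-vertex u c u∈V uc =
    suc-injective (trans (∣∣-remove (∁ u) c (trans (!-∁ u c) (cong not uc))) (∣∁∣-vertex u u∈V))

  across-edge : ∀ u c → Vx u → u ! c ≡ false → S ! c ≡ false → E u (across u c)
  across-edge u c u∈V uc sc = (u∈V , across-vertex u c u∈V uc , disjoint) , colour∉S
    where
    disjoint : Disjoint n u (across u c)
    disjoint x x∈u with c ≟ᶠ x
    ... | yes refl = !⇒∉ (!-≔-same (∁ u) c false)
    ... | no c≢x = !⇒∉ (trans (!-across u c≢x) (cong not (∈⇒! x∈u)))
    colour∉S : ∀ c' → IsColour n u (across u c) c' → c' ∉ₛ S
    colour∉S c' (c'∉u , c'∉w) with c ≟ᶠ c'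
    ... | yes refl = !⇒∉ sc
    ... | no c≢c' = ⊥-elim (not-¬ (∉⇒! c'∉w) (trans (!-across u c≢c') (cong not (∉⇒! c'∉u))))

  edge-across : ∀ u w → E u w → ∃ λ c → free u ! c ≡ true × w ≡ across u c
  edge-across u w ((u∈V , w∈V , disjoint) , colour∉S) = c , ⇒free u c uc sc , w≡
    where
    w⊑∁u : w ⊑ ∁ u
    w⊑∁u x wx with u ! x in ux
    ... | true = ⊥-elim (disjoint x (!⇒∈ ux) (!⇒∈ wx))
    ... | false = trans (!-∁ u x) (cong not ux)
    one-missing : ∃ λ c → ∁ u ! c ≡ true × w ≡ across u c
    one-missing = remove-one w⊑∁u (trans (cong suc w∈V) (sym (∣∁∣-vertex u u∈V)))
    c = proj₁ one-missing
    w≡ = proj₂ (proj₂ one-missing)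
    uc : u ! c ≡ false
    uc = not≡true (trans (sym (!-∁ u c)) (proj₁ (proj₂ one-missing)))
    wc : w ! c ≡ false
    wc = trans (cong (_! c) w≡) (!-≔-same (∁ u) c false)
    sc : S ! c ≡ false
    sc = ∉⇒! (colour∉S c (!⇒∉ uc , !⇒∉ wc))

  neighbours : V → List V
  neighbours u = map (across u) (members (free u))

  has-degree : ∀ u → Vx u → HasDegree u ∣ free u ∣
  has-degree u u∈V =
    neighbours u ,
    trans (length-map (across u) (members (free u))) (length-members (free u)) ,
    map-Unique (across u) (Unique-members (free u)) across-injective ,
    λ w → mk⇔ (to w) (from w)
    where
    member⇒free : ∀ {c} → c ∈ᴸ members (free u) → free u ! c ≡ true
    member⇒free {c} = Equivalence.to (∈-members (free u) c)
    across-injective : ∀ {c c'} → c ∈ᴸ members (free u) → c' ∈ᴸ members (free u) →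
      across u c ≡ across u c' → c ≡ c'
    across-injective {c} {c'} p _ e with c ≟ᶠ c'
    ... | yes c≡c' = c≡c'
    ... | no c≢c' = ⊥-elim (not-¬ (!-≔-same (∁ u) c false) (begin
      across u c ! c   ≡⟨ cong (_! c) e ⟩
      across u c' ! c  ≡⟨ !-across u (λ e' → c≢c' (sym e')) ⟩
      not (u ! c)      ≡⟨ cong not (proj₁ (free⇒ u c (member⇒free p))) ⟩
      not false        ∎))
      where open ≡-Reasoning
    to : ∀ w → w ∈ᴸ neighbours u → E u w
    to w p with c , q , refl ← ∈-map⁻ (across u) p =
      let (uc , sc) = free⇒ u c (member⇒free q) in across-edge u c u∈V uc sc
    from : ∀ w → E u w → w ∈ᴸ neighbours u
    from w e with c , fc , refl ← edge-across u w e =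
      ∈-map⁺ (across u) (Equivalence.from (∈-members (free u) c) fc)

  degree-unique : ∀ u d → Vx u → HasDegree u d → d ≡ ∣ free u ∣
  degree-unique u d u∈V (L , ∣L∣ , L-unique , L-nbrs) with has-degree u u∈V
  ... | (L' , ∣L'∣ , L'-unique , L'-nbrs) = begin
    d          ≡⟨ sym ∣L∣ ⟩
    length L   ≡⟨ Unique-length L L' L-unique L'-unique same-members ⟩
    length L'  ≡⟨ ∣L'∣ ⟩
    ∣ free u ∣ ∎
    where
    open ≡-Reasoning
    same-members : ∀ w → w ∈ᴸ L ⇔ w ∈ᴸ L'
    same-members w = mk⇔ (Equivalence.from (L'-nbrs w) ∘ Equivalence.to (L-nbrs w))
                         (Equivalence.from (L-nbrs w) ∘ Equivalence.to (L'-nbrs w))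

  ∣free∣ : ∀ u → Vx u → ∣ S ∣ ≤ n → ∣ free u ∣ ≡ (n ∸ ∣ S ∣) + ∣ trace u ∣
  ∣free∣ u u∈V ∣S∣≤n = +-cancelʳ-≡ (n' + ∣ S ∣) _ _ (begin
    ∣ free u ∣ + (n' + ∣ S ∣)                ≡⟨ sym (+-assoc (∣ free u ∣) n' (∣ S ∣)) ⟩
    ∣ free u ∣ + n' + ∣ S ∣                  ≡⟨ cong (λ z → ∣ free u ∣ + z + ∣ S ∣) (sym u∈V) ⟩
    ∣ free u ∣ + ∣ u ∣ + ∣ S ∣               ≡⟨ ∣∣-outside-both u S ⟩
    2 * n ∸ 1 + ∣ trace u ∣                  ≡⟨ cong (_+ ∣ trace u ∣) ground-size ⟩
    n' + n + ∣ trace u ∣                     ≡⟨ cong (λ z → n' + z + ∣ trace u ∣) (sym (m∸n+n≡m ∣S∣≤n)) ⟩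
    n' + (n ∸ ∣ S ∣ + ∣ S ∣) + ∣ trace u ∣   ≡⟨ regroup n' (n ∸ ∣ S ∣) (∣ S ∣) (∣ trace u ∣) ⟩
    (n ∸ ∣ S ∣) + ∣ trace u ∣ + (n' + ∣ S ∣) ∎)
    where
    open ≡-Reasoning
    regroup : ∀ a d s t → a + (d + s) + t ≡ d + t + (a + s)
    regroup = solve-∀

  open RelativeComplement S public

  trace-⊑ : ∀ u → trace u ⊑ S
  trace-⊑ u x e = ∧-conicalʳ _ _ (trans (sym (!-∩ u S x)) e)

  trace-across : ∀ u w → E u w → trace w ≡ S ─ trace u
  trace-across u w e with c , fc , refl ← edge-across u w e =
    subset-ext λ x → trans (!-∩ (across u c) S x) (pointwise x)
    where
    sc = proj₂ (free⇒ u c fc)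
    rhs : ∀ x → (S ─ trace u) ! x ≡ S ! x ∧ not (u ! x ∧ S ! x)
    rhs x = trans (!-─ S (trace u) x) (cong (λ z → S ! x ∧ not z) (!-∩ u S x))
    pointwise : ∀ x → across u c ! x ∧ S ! x ≡ (S ─ trace u) ! x
    pointwise x with c ≟ᶠ x
    ... | yes refl = trans (cong₂ _∧_ (!-≔-same (∁ u) c false) sc)
                           (sym (trans (rhs c) (cong (λ s → s ∧ not (u ! c ∧ s)) sc)))
    ... | no c≢x = trans (cong (_∧ S ! x) (!-across u c≢x)) (trans (bool (u ! x) (S ! x)) (sym (rhs x)))
      where
      bool : ∀ a s → not a ∧ s ≡ s ∧ not (a ∧ s)
      bool true true = refl
      bool true false = refl
      bool false true = refl
      bool false false = refl

  -- Crossing colour y and then colour x trades x for y and keeps all else.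
  swap : V → Ground n → Ground n → V
  swap u x y = across (across u y) x

  !-swap-other : ∀ u {x y z} → x ≢ z → y ≢ z → swap u x y ! z ≡ u ! z
  !-swap-other u {x} {y} {z} x≢z y≢z =
    trans (!-across (across u y) x≢z) (trans (cong not (!-across u y≢z)) (not-involutive (u ! z)))

  !-swap-new : ∀ u {x y} → x ≢ y → swap u x y ! y ≡ true
  !-swap-new u {x} {y} x≢y = trans (!-across (across u y) x≢y) (cong not (!-≔-same (∁ u) y false))

  outside-S : ∀ a b → trace a ≡ trace b → ∀ z → a ! z ≡ true → b ! z ≡ false → S ! z ≡ false
  outside-S a b same z az bz with S ! z in sz
  ... | false = refl
  ... | true = ⊥-elim (not-¬ b∧S (cong (_∧ true) bz))
    where
    b∧S : b ! z ∧ true ≡ true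
    b∧S = trans (sym (trans (!-∩ b S z) (cong (b ! z ∧_) sz)))
            (trans (cong (_! z) (sym same)) (trans (!-∩ a S z) (cong₂ _∧_ az sz)))

  swap-walk : ∀ u x y → Vx u → u ! x ≡ true → u ! y ≡ false → S ! x ≡ false → S ! y ≡ false →
    Vx (swap u x y) × Star E u (swap u x y) × trace (swap u x y) ≡ trace u
  swap-walk u x y u∈V ux uy Sx Sy =
    across-vertex w x w∈V wx , first ◅ second ◅ ε ,
    trans (trace-across w _ second) (trans (cong (S ─_) (trace-across u w first)) (─-involutive (trace u) (trace-⊑ u)))
    where
    w = across u y
    w∈V = across-vertex u y u∈V uy
    wx : w ! x ≡ false
    wx = trans (!-across u (λ y≡x → not-¬ ux (trans (cong (u !_) (sym y≡x)) uy))) (cong not ux)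
    first = across-edge u y u∈V uy Sy
    second = across-edge w x w∈V wx Sx

  swap-closer : ∀ u u' {x y} → u ! x ≡ true → u' ! x ≡ false → u ! y ≡ false → u' ! y ≡ true →
    swap u x y ─ u' ≡ (u ─ u') [ x ]≔ false
  swap-closer u u' {x} {y} ux u'x uy u'y = subset-ext pointwise
    where
    x≢y : x ≢ y
    x≢y x≡y = not-¬ ux (trans (cong (u !_) x≡y) uy)
    pointwise : ∀ z → (swap u x y ─ u') ! z ≡ ((u ─ u') [ x ]≔ false) ! z
    pointwise z with x ≟ᶠ z | y ≟ᶠ z
    ... | yes refl | _ = trans (!-─ (swap u x y) u' x)
      (trans (cong (_∧ not (u' ! x)) (!-≔-same (∁ (across u y)) x false)) (sym (!-≔-same (u ─ u') x false)))
    ... | no x≢z | yes refl = trans (!-─ (swap u x y) u' y)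
      (trans (cong₂ (λ a b → a ∧ not b) (!-swap-new u x≢y) u'y)
        (sym (trans (!-≔-other (u ─ u') false x≢z) (trans (!-─ u u' y) (cong (_∧ not (u' ! y)) uy)))))
    ... | no x≢z | no y≢z = trans (!-─ (swap u x y) u' z)
      (trans (cong (_∧ not (u' ! z)) (!-swap-other u x≢z y≢z))
        (sym (trans (!-≔-other (u ─ u') false x≢z) (!-─ u u' z))))

  -- Vertices with the same trace are joined by a walk, by induction on the
  -- number d of elements of u missing from u' (each swap removes one).
  same-trace-walk : ∀ d u u' → Vx u → Vx u' → trace u ≡ trace u' → ∣ u ─ u' ∣ ≡ d → Star E u u'
  same-trace-walk zero u u' u∈V u'∈V same ∣u─u'∣ =
    subst (Star E u) (⊑-equal-size u⊑u' (trans u∈V (sym u'∈V))) ε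
    where
    u⊑u' : u ⊑ u'
    u⊑u' x ux with u' ! x in u'x
    ... | true = refl
    ... | false = ⊥-elim (<-irrefl (sym ∣u─u'∣) (member⇒nonzero (u ─ u') x
                    (trans (!-─ u u' x) (cong₂ (λ a b → a ∧ not b) ux u'x))))
  same-trace-walk (suc d) u u' u∈V u'∈V same ∣u─u'∣ =
    walk ◅◅ same-trace-walk d (swap u x y) u' swap∈V u'∈V (trans swap-trace same) ∣swap─u'∣
    where
    x-found = nonempty (u ─ u') (subst (0 <_) (sym ∣u─u'∣) (s≤s z≤n))
    y-found = nonempty (u' ─ u)
      (subst (0 <_) (sym (trans (sym (∣─∣-sym u u' (trans u∈V (sym u'∈V)))) ∣u─u'∣)) (s≤s z≤n))
    x = proj₁ x-found
    y = proj₁ y-found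
    ux = ∧-conicalˡ _ _ (trans (sym (!-─ u u' x)) (proj₂ x-found))
    u'x = not≡true (∧-conicalʳ _ _ (trans (sym (!-─ u u' x)) (proj₂ x-found)))
    u'y = ∧-conicalˡ _ _ (trans (sym (!-─ u' u y)) (proj₂ y-found))
    uy = not≡true (∧-conicalʳ _ _ (trans (sym (!-─ u' u y)) (proj₂ y-found)))
    swapped = swap-walk u x y u∈V ux uy (outside-S u u' same x ux u'x) (outside-S u' u (sym same) y u'y uy)
    swap∈V = proj₁ swapped
    walk = proj₁ (proj₂ swapped)
    swap-trace = proj₂ (proj₂ swapped)
    ∣swap─u'∣ : ∣ swap u x y ─ u' ∣ ≡ d
    ∣swap─u'∣ = suc-injective (trans (cong (λ z → suc ∣ z ∣) (swap-closer u u' ux u'x uy u'y))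
                  (trans (∣∣-remove (u ─ u') x (proj₂ x-found)) ∣u─u'∣))

  -- u's trace is B or its complement S ─ B.  By trace-across and
  -- same-trace-walk these classes are exactly the components of O_n(S).
  TraceIn : V → V → Set
  TraceIn B u = trace u ≡ B ⊎ trace u ≡ S ─ B

  TraceIn-─ : ∀ B → B ⊑ S → ∀ u → TraceIn B u → TraceIn (S ─ B) u
  TraceIn-─ B B⊑S u (inj₁ t≡B) = inj₂ (trans t≡B (sym (─-involutive B B⊑S)))
  TraceIn-─ B B⊑S u (inj₂ t≡S─B) = inj₁ t≡S─B

  walk-TraceIn : ∀ B → B ⊑ S → ∀ {a b} → Star E a b → TraceIn B a → TraceIn B b
  walk-TraceIn B B⊑S ε t∈ = t∈
  walk-TraceIn B B⊑S (_◅_ {i = a} {j = a'} e walk) (inj₁ t≡B) =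
    walk-TraceIn B B⊑S walk (inj₂ (trans (trace-across a a' e) (cong (S ─_) t≡B)))
  walk-TraceIn B B⊑S (_◅_ {i = a} {j = a'} e walk) (inj₂ t≡S─B) =
    walk-TraceIn B B⊑S walk (inj₁ (trans (trace-across a a' e)
      (trans (cong (S ─_) t≡S─B) (─-involutive B B⊑S))))

  component-TraceIn : ∀ r w → Star E r w → TraceIn (trace r) w
  component-TraceIn r w walk = walk-TraceIn (trace r) (trace-⊑ r) walk (inj₁ refl)

  -- Conversely every vertex of the class of trace r is reachable from r:
  -- if its trace is complementary, first step to any neighbour of r
  -- (one exists since r has n - ∣ S ∣ + ∣ trace r ∣ > 0 free colours).
  TraceIn-reachable : ∣ S ∣ ≤ n' → ∀ r w → Vx r → Vx w → TraceIn (trace r) w → Star E r w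
  TraceIn-reachable _ r w r∈V w∈V (inj₁ same) = same-trace-walk _ r w r∈V w∈V (sym same) refl
  TraceIn-reachable ∣S∣≤n' r w r∈V w∈V (inj₂ complementary) =
    step ◅ same-trace-walk _ (across r c) w (across-vertex r c r∈V rc) w∈V
             (trans (trace-across r _ step) (sym complementary)) refl
    where
    free≢∅ : 0 < ∣ free r ∣
    free≢∅ = subst (0 <_) (sym (∣free∣ r r∈V (≤-trans ∣S∣≤n' (n≤1+n n'))))
               (≤-trans (m<n⇒0<n∸m (s≤s ∣S∣≤n')) (m≤m+n (n ∸ ∣ S ∣) _))
    c = proj₁ (nonempty (free r) free≢∅)
    rc = proj₁ (free⇒ r c (proj₂ (nonempty (free r) free≢∅)))
    step = across-edge r c r∈V rc (proj₂ (free⇒ r c (proj₂ (nonempty (free r) free≢∅))))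

  retrace : V → V → V
  retrace u X = (u ─ S) ∪ X

  private
    ⊑S-outside : ∀ X → X ⊑ S → ∀ x → S ! x ≡ false → X ! x ≡ false
    ⊑S-outside X X⊑S x Sx with X ! x in Xx
    ... | false = refl
    ... | true = trans (sym (X⊑S x Xx)) Sx

  !-retrace : ∀ u X x → retrace u X ! x ≡ (u ! x ∧ not (S ! x)) ∨ X ! x
  !-retrace u X x = trans (!-∪ (u ─ S) X x) (cong (_∨ X ! x) (!-─ u S x))

  retrace-outside : ∀ u X → X ⊑ S → ∀ x → S ! x ≡ false → retrace u X ! x ≡ u ! x
  retrace-outside u X X⊑S x Sx = trans (!-retrace u X x)
    (trans (cong₂ (λ s y → (u ! x ∧ not s) ∨ y) Sx (⊑S-outside X X⊑S x Sx))
      (trans (∨-identityʳ _) (∧-identityʳ _)))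

  trace-retrace : ∀ u X → X ⊑ S → trace (retrace u X) ≡ X
  trace-retrace u X X⊑S = subset-ext λ x → trans (!-∩ (retrace u X) S x) (pointwise x)
    where
    pointwise : ∀ x → retrace u X ! x ∧ S ! x ≡ X ! x
    pointwise x with S ! x in Sx
    ... | false = trans (∧-zeroʳ _) (sym (⊑S-outside X X⊑S x Sx))
    ... | true = trans (∧-identityʳ _) (trans (!-retrace u X x)
                   (trans (cong (λ s → (u ! x ∧ not s) ∨ X ! x) Sx) (cong (_∨ X ! x) (∧-zeroʳ (u ! x)))))

  retrace-─S : ∀ u X → X ⊑ S → retrace u X ─ S ≡ u ─ S
  retrace-─S u X X⊑S = subset-ext λ x →
    trans (!-─ (retrace u X) S x) (trans (pointwise x) (sym (!-─ u S x)))
    where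
    pointwise : ∀ x → retrace u X ! x ∧ not (S ! x) ≡ u ! x ∧ not (S ! x)
    pointwise x with S ! x in Sx
    ... | true = trans (∧-zeroʳ _) (sym (∧-zeroʳ _))
    ... | false = cong (_∧ true) (retrace-outside u X X⊑S x Sx)

  retrace-trace : ∀ u → retrace u (trace u) ≡ u
  retrace-trace u = subset-ext λ x →
    trans (!-retrace u (trace u) x) (trans (cong ((u ! x ∧ not (S ! x)) ∨_) (!-∩ u S x)) (bool (u ! x) (S ! x)))
    where
    bool : ∀ a s → (a ∧ not s) ∨ (a ∧ s) ≡ a
    bool true true = refl
    bool true false = refl
    bool false true = refl
    bool false false = refl

  retrace-retrace : ∀ u X Y → X ⊑ S → retrace (retrace u X) Y ≡ retrace u Y
  retrace-retrace u X Y X⊑S = cong (_∪ Y) (retrace-─S u X X⊑S)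

  ∣retrace∣ : ∀ u X → X ⊑ S → ∣ retrace u X ∣ ≡ ∣ X ∣ + ∣ u ─ S ∣
  ∣retrace∣ u X X⊑S = trans (∣∣-split (retrace u X) S)
    (cong₂ (λ a b → ∣ a ∣ + ∣ b ∣) (trace-retrace u X X⊑S) (retrace-─S u X X⊑S))

  edge-by-parts : ∀ a b → Vx a → Vx b → trace b ≡ S ─ trace a →
    (∀ x → S ! x ≡ false → a ! x ≡ true → b ! x ≡ false) → E a b
  edge-by-parts a b a∈V b∈V complementary disjoint-outside = (a∈V , b∈V , disjoint) , colour∉S
    where
    on-S : ∀ x → S ! x ≡ true → b ! x ≡ not (a ! x)
    on-S x Sx = begin
      b ! x                        ≡⟨ sym (∧-identityʳ _) ⟩
      b ! x ∧ true                 ≡⟨ cong (b ! x ∧_) (sym Sx) ⟩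
      b ! x ∧ S ! x                ≡⟨ sym (!-∩ b S x) ⟩
      trace b ! x                  ≡⟨ cong (_! x) complementary ⟩
      (S ─ trace a) ! x            ≡⟨ trans (!-─ S (trace a) x) (cong (λ z → S ! x ∧ not z) (!-∩ a S x)) ⟩
      S ! x ∧ not (a ! x ∧ S ! x)  ≡⟨ cong (λ s → s ∧ not (a ! x ∧ s)) Sx ⟩
      not (a ! x ∧ true)           ≡⟨ cong not (∧-identityʳ _) ⟩
      not (a ! x)                  ∎
      where open ≡-Reasoning
    disjoint : Disjoint n a b
    disjoint x x∈a with S ! x in Sx
    ... | false = !⇒∉ (disjoint-outside x Sx (∈⇒! x∈a))
    ... | true = !⇒∉ (trans (on-S x Sx) (cong not (∈⇒! x∈a)))
    colour∉S : ∀ c → IsColour n a b c → c ∉ₛ S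
    colour∉S c (c∉a , c∉b) c∈S =
      not-¬ (∉⇒! c∉b) (trans (on-S c (∈⇒! c∈S)) (cong not (∉⇒! c∉a)))

  _≟ⱽ_ : (a b : V) → Dec (a ≡ b)
  _≟ⱽ_ = Vec-≡-dec _≟ᵇ_

  newTrace : V → V → V → V
  newTrace B₁ B₂ u = if does (trace u ≟ⱽ B₁) then B₂ else S ─ B₂

  -- Relabelling moves the class of B₁ onto the class of B₂.
  relabel : V → V → V → V
  relabel B₁ B₂ u = retrace u (newTrace B₁ B₂ u)

  newTrace-yes : ∀ B₁ B₂ u → trace u ≡ B₁ → newTrace B₁ B₂ u ≡ B₂
  newTrace-yes B₁ B₂ u t≡B₁ with trace u ≟ⱽ B₁
  ... | yes _ = refl
  ... | no t≢B₁ = ⊥-elim (t≢B₁ t≡B₁)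

  newTrace-no : ∀ B₁ B₂ u → trace u ≢ B₁ → newTrace B₁ B₂ u ≡ S ─ B₂
  newTrace-no B₁ B₂ u t≢B₁ with trace u ≟ⱽ B₁
  ... | yes t≡B₁ = ⊥-elim (t≢B₁ t≡B₁)
  ... | no _ = refl

  -- Between two classes whose traces B₁, B₂ have equal size (and S ≠ ∅,
  -- so that the two sides of a class differ) relabelling is a graph
  -- isomorphism, with inverse the relabelling from B₂ back to B₁.
  module Relabel (S≢∅ : 0 < ∣ S ∣) (B₁ B₂ : V) (B₁⊑S : B₁ ⊑ S) (B₂⊑S : B₂ ⊑ S)
                 (∣B₁∣≡∣B₂∣ : ∣ B₁ ∣ ≡ ∣ B₂ ∣) where

    F : V → V
    F = relabel B₁ B₂

    newTrace-⊑ : ∀ u → newTrace B₁ B₂ u ⊑ S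
    newTrace-⊑ u with trace u ≟ⱽ B₁
    ... | yes _ = B₂⊑S
    ... | no _ = ─-⊑ B₂

    sides : ∀ u → TraceIn B₁ u →
      (trace u ≡ B₁ × trace (F u) ≡ B₂) ⊎ (trace u ≡ S ─ B₁ × trace (F u) ≡ S ─ B₂)
    sides u (inj₁ t≡B₁) =
      inj₁ (t≡B₁ , trans (trace-retrace u _ (newTrace-⊑ u)) (newTrace-yes B₁ B₂ u t≡B₁))
    sides u (inj₂ t≡S─B₁) =
      inj₂ (t≡S─B₁ , trans (trace-retrace u _ (newTrace-⊑ u))
                       (newTrace-no B₁ B₂ u (λ t≡B₁ → ─-no-fixpoint S≢∅ B₁ (trans (sym t≡B₁) t≡S─B₁))))

    F-TraceIn : ∀ u → TraceIn B₁ u → TraceIn B₂ (F u)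
    F-TraceIn u t∈ with sides u t∈
    ... | inj₁ (_ , p) = inj₁ p
    ... | inj₂ (_ , p) = inj₂ p

    F-vertex : ∀ u → Vx u → TraceIn B₁ u → Vx (F u)
    F-vertex u u∈V t∈ = begin
      ∣ F u ∣                             ≡⟨ ∣retrace∣ u _ (newTrace-⊑ u) ⟩
      ∣ newTrace B₁ B₂ u ∣ + ∣ u ─ S ∣    ≡⟨ cong (_+ ∣ u ─ S ∣) same-size ⟩
      ∣ trace u ∣ + ∣ u ─ S ∣             ≡⟨ sym (∣∣-split u S) ⟩
      ∣ u ∣                               ≡⟨ u∈V ⟩
      n'                                  ∎
      where
      open ≡-Reasoning
      new≡ : ∀ {X} → trace (F u) ≡ X → newTrace B₁ B₂ u ≡ X
      new≡ p = trans (sym (trace-retrace u _ (newTrace-⊑ u))) p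
      same-size : ∣ newTrace B₁ B₂ u ∣ ≡ ∣ trace u ∣
      same-size with sides u t∈
      ... | inj₁ (t≡B₁ , p) = trans (cong ∣_∣ (new≡ p)) (trans (sym ∣B₁∣≡∣B₂∣) (cong ∣_∣ (sym t≡B₁)))
      ... | inj₂ (t≡S─B₁ , p) = trans (cong ∣_∣ (new≡ p)) (trans (∣─∣ B₂ B₂⊑S)
              (trans (cong (∣ S ∣ ∸_) (sym ∣B₁∣≡∣B₂∣)) (trans (sym (∣─∣ B₁ B₁⊑S)) (cong ∣_∣ (sym t≡S─B₁)))))

    F-inverse : ∀ u → TraceIn B₁ u → relabel B₂ B₁ (F u) ≡ u
    F-inverse u t∈ = trans (retrace-retrace u _ _ (newTrace-⊑ u)) (trans (cong (retrace u) back) (retrace-trace u))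
      where
      back : newTrace B₂ B₁ (F u) ≡ trace u
      back with sides u t∈
      ... | inj₁ (t≡B₁ , p) = trans (newTrace-yes B₂ B₁ (F u) p) (sym t≡B₁)
      ... | inj₂ (t≡S─B₁ , p) =
        trans (newTrace-no B₂ B₁ (F u) (λ q → ─-no-fixpoint S≢∅ B₂ (trans (sym q) p))) (sym t≡S─B₁)

    F-edge : ∀ u u' → TraceIn B₁ u → TraceIn B₁ u' → E u u' → E (F u) (F u')
    F-edge u u' t∈ t∈' e@((u∈V , u'∈V , disjoint) , _) =
      edge-by-parts (F u) (F u') (F-vertex u u∈V t∈) (F-vertex u' u'∈V t∈') complementary disjoint-outside
      where
      flips = trace-across u u' e
      complementary : trace (F u') ≡ S ─ trace (F u)
      complementary with sides u t∈ | sides u' t∈'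
      ... | inj₁ (q , p) | inj₁ (q' , p') =
        ⊥-elim (─-no-fixpoint S≢∅ B₁ (trans (sym q') (trans flips (cong (S ─_) q))))
      ... | inj₁ (q , p) | inj₂ (q' , p') = trans p' (cong (S ─_) (sym p))
      ... | inj₂ (q , p) | inj₁ (q' , p') = trans p' (trans (sym (─-involutive B₂ B₂⊑S)) (cong (S ─_) (sym p)))
      ... | inj₂ (q , p) | inj₂ (q' , p') =
        ⊥-elim (─-no-fixpoint S≢∅ B₁ (sym (trans (sym q') (trans flips (trans (cong (S ─_) q) (─-involutive B₁ B₁⊑S))))))
      disjoint-outside : ∀ x → S ! x ≡ false → F u ! x ≡ true → F u' ! x ≡ false
      disjoint-outside x Sx Fux = trans (retrace-outside u' _ (newTrace-⊑ u') x Sx)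
        (∉⇒! (disjoint x (!⇒∈ (trans (sym (retrace-outside u _ (newTrace-⊑ u) x Sx)) Fux))))

  TraceIn-─⁻ : ∀ B → B ⊑ S → ∀ u → TraceIn (S ─ B) u → TraceIn B u
  TraceIn-─⁻ B B⊑S u (inj₁ t≡S─B) = inj₂ t≡S─B
  TraceIn-─⁻ B B⊑S u (inj₂ t≡S─S─B) = inj₁ (trans t≡S─S─B (─-involutive B B⊑S))

  component⇒TraceIn : ∀ B → B ⊑ S → ∀ r → TraceIn B r → ∀ w → Star E r w → TraceIn B w
  component⇒TraceIn B B⊑S r (inj₁ refl) w walk = component-TraceIn r w walk
  component⇒TraceIn B B⊑S r (inj₂ t≡S─B) w walk =
    TraceIn-─⁻ B B⊑S w (subst (λ X → TraceIn X w) t≡S─B (component-TraceIn r w walk))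

  TraceIn⇒component : ∣ S ∣ ≤ n' → ∀ B → B ⊑ S → ∀ r → Vx r → TraceIn B r →
    ∀ w → Vx w → TraceIn B w → Star E r w
  TraceIn⇒component ∣S∣≤n' B B⊑S r r∈V (inj₁ refl) w w∈V t∈ =
    TraceIn-reachable ∣S∣≤n' r w r∈V w∈V t∈
  TraceIn⇒component ∣S∣≤n' B B⊑S r r∈V (inj₂ t≡S─B) w w∈V t∈ =
    TraceIn-reachable ∣S∣≤n' r w r∈V w∈V (subst (λ X → TraceIn X w) (sym t≡S─B) (TraceIn-─ B B⊑S w t∈))

  classes-isomorphic : 0 < ∣ S ∣ → ∣ S ∣ ≤ n' → ∀ B₁ B₂ → B₁ ⊑ S → B₂ ⊑ S → ∣ B₁ ∣ ≡ ∣ B₂ ∣ →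
    ∀ r₁ r₂ → Vx r₁ → Vx r₂ → TraceIn B₁ r₁ → TraceIn B₂ r₂ → IsoComp r₁ r₂
  classes-isomorphic S≢∅ ∣S∣≤n' B₁ B₂ B₁⊑S B₂⊑S ∣B₁∣≡∣B₂∣ r₁ r₂ r₁∈V r₂∈V r₁∈B₁ r₂∈B₂ =
    To.F , From.F ,
    (λ w (w∈V , walk) → let w∈B₁ = in₁ w walk in To.F-vertex w w∈V w∈B₁ , to-reachable w w∈V w∈B₁) ,
    (λ w (w∈V , walk) → let w∈B₂ = in₂ w walk in From.F-vertex w w∈V w∈B₂ , from-reachable w w∈V w∈B₂) ,
    (λ w (_ , walk) → To.F-inverse w (in₁ w walk)) ,
    (λ w (_ , walk) → From.F-inverse w (in₂ w walk)) ,
    λ w w' (_ , walk) (_ , walk') → let w∈B₁ = in₁ w walk ; w'∈B₁ = in₁ w' walk' in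
      mk⇔ (To.F-edge w w' w∈B₁ w'∈B₁)
          (λ e → subst₂ E (To.F-inverse w w∈B₁) (To.F-inverse w' w'∈B₁)
                   (From.F-edge _ _ (To.F-TraceIn w w∈B₁) (To.F-TraceIn w' w'∈B₁) e))
    where
    module To = Relabel S≢∅ B₁ B₂ B₁⊑S B₂⊑S ∣B₁∣≡∣B₂∣
    module From = Relabel S≢∅ B₂ B₁ B₂⊑S B₁⊑S (sym ∣B₁∣≡∣B₂∣)
    in₁ = component⇒TraceIn B₁ B₁⊑S r₁ r₁∈B₁
    in₂ = component⇒TraceIn B₂ B₂⊑S r₂ r₂∈B₂
    to-reachable : ∀ w → Vx w → TraceIn B₁ w → Star E r₂ (To.F w)
    to-reachable w w∈V w∈B₁ = TraceIn⇒component ∣S∣≤n' B₂ B₂⊑S r₂ r₂∈V r₂∈B₂ _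
                                (To.F-vertex w w∈V w∈B₁) (To.F-TraceIn w w∈B₁)
    from-reachable : ∀ w → Vx w → TraceIn B₂ w → Star E r₁ (From.F w)
    from-reachable w w∈V w∈B₂ = TraceIn⇒component ∣S∣≤n' B₁ B₁⊑S r₁ r₁∈V r₁∈B₁ _
                                  (From.F-vertex w w∈V w∈B₂) (From.F-TraceIn w w∈B₂)

  -- Every B ⊑ S small enough is the trace of some vertex: fill up with
  -- elements outside S (there are at least n' of them).
  vertex-with-trace : ∣ S ∣ ≤ n → ∀ B → B ⊑ S → ∣ B ∣ ≤ n' → Σ V λ u → Vx u × trace u ≡ B
  vertex-with-trace ∣S∣≤n B B⊑S ∣B∣≤n' = retrace y B , size , trace-retrace y B B⊑S
    where
    n'≤∣∁S∣ : n' ≤ ∣ ∁ S ∣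
    n'≤∣∁S∣ = +-cancelʳ-≤ (∣ S ∣) n' (∣ ∁ S ∣) (begin
      n' + ∣ S ∣      ≤⟨ +-monoʳ-≤ n' ∣S∣≤n ⟩
      n' + n          ≡⟨ sym ground-size ⟩
      2 * n ∸ 1       ≡⟨ sym (∣∣-∁ S) ⟩
      ∣ S ∣ + ∣ ∁ S ∣ ≡⟨ +-comm (∣ S ∣) (∣ ∁ S ∣) ⟩
      ∣ ∁ S ∣ + ∣ S ∣ ∎)
      where open ≤-Reasoning
    filler = subset-of-size (∁ S) (n' ∸ ∣ B ∣) (≤-trans (m∸n≤m n' ∣ B ∣) n'≤∣∁S∣)
    y = proj₁ filler
    y─S≡y : y ─ S ≡ y
    y─S≡y = subset-ext λ x → trans (!-─ y S x) (pointwise x)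
      where
      pointwise : ∀ x → y ! x ∧ not (S ! x) ≡ y ! x
      pointwise x with y ! x in yx
      ... | false = refl
      ... | true = trans (sym (!-∁ S x)) (proj₁ (proj₂ filler) x yx)
    size : Vx (retrace y B)
    size = begin
      ∣ retrace y B ∣         ≡⟨ ∣retrace∣ y B B⊑S ⟩
      ∣ B ∣ + ∣ y ─ S ∣       ≡⟨ cong (λ z → ∣ B ∣ + ∣ z ∣) y─S≡y ⟩
      ∣ B ∣ + ∣ y ∣           ≡⟨ cong (∣ B ∣ +_) (proj₂ (proj₂ filler)) ⟩
      ∣ B ∣ + (n' ∸ ∣ B ∣)    ≡⟨ m+[n∸m]≡n ∣B∣≤n' ⟩
      n'                      ∎
      where open ≡-Reasoning

module BiregularComponents (n' k : ℕ) (S : Sub (suc n')) (∣S∣≡k : ∣ S ∣ ≡ k)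
                           (0<k : 0 < k) (k≤n' : k ≤ n') (i : ℕ) (i≤k : i ≤ k) where

  open ColouredOddGraph n' S

  P : V → Set
  P = BiregularComp (n ∸ i) (n ∸ k + i)

  S≢∅ : 0 < ∣ S ∣
  S≢∅ = subst (0 <_) (sym ∣S∣≡k) 0<k

  ∣S∣≤n' : ∣ S ∣ ≤ n'
  ∣S∣≤n' = subst (_≤ n') (sym ∣S∣≡k) k≤n'

  k≤n : k ≤ n
  k≤n = ≤-trans k≤n' (n≤1+n n')

  degree : ∀ u → Vx u → ∣ free u ∣ ≡ (n ∸ k) + ∣ trace u ∣
  degree u u∈V = trans (∣free∣ u u∈V (≤-trans ∣S∣≤n' (n≤1+n n'))) (cong (λ s → (n ∸ s) + ∣ trace u ∣) ∣S∣≡k)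

  n∸k+[k∸i]≡n∸i : (n ∸ k) + (k ∸ i) ≡ n ∸ i
  n∸k+[k∸i]≡n∸i = trans (sym (+-∸-assoc (n ∸ k) i≤k)) (cong (_∸ i) (m∸n+n≡m k≤n))

  ∣S─∣ : ∀ B → B ⊑ S → ∣ S ─ B ∣ ≡ k ∸ ∣ B ∣
  ∣S─∣ B B⊑S = trans (∣─∣ B B⊑S) (cong (_∸ ∣ B ∣) ∣S∣≡k)

  -- A component that is a class with traces A and S ─ A, where ∣ A ∣ = k - i,
  -- is (n - i, n - k + i)-biregular, the side being decided by the trace.
  class⇒P : ∀ r A → A ⊑ S → ∣ A ∣ ≡ k ∸ i → (∀ w → InComp r w → TraceIn A w) → P r
  class⇒P r A A⊑S ∣A∣ class = side , bipartite , degree-A , degree-S─A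
    where
    side : V → Bool
    side w = does (trace w ≟ⱽ A)
    bipartite : ∀ w w' → InComp r w → InComp r w' → E w w' → side w ≢ side w'
    bipartite w w' w∈ _ e with trace w ≟ⱽ A | trace w' ≟ⱽ A
    ... | yes p | yes p' = λ _ → ─-no-fixpoint S≢∅ A (trans (sym p') (trans (trace-across w w' e) (cong (S ─_) p)))
    ... | yes _ | no _ = λ ()
    ... | no _ | yes _ = λ ()
    ... | no w≢A | no w'≢A with class w w∈
    ...   | inj₁ p = ⊥-elim (w≢A p)
    ...   | inj₂ p = ⊥-elim (w'≢A (trans (trace-across w w' e) (trans (cong (S ─_) p) (─-involutive A A⊑S))))
    degree-A : ∀ w → InComp r w → side w ≡ true → HasDegree w (n ∸ i)
    degree-A w (w∈V , _) _ with trace w ≟ⱽ A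
    ... | yes p = subst (HasDegree w)
        (trans (degree w w∈V) (trans (cong (λ B → (n ∸ k) + ∣ B ∣) p) (trans (cong ((n ∸ k) +_) ∣A∣) n∸k+[k∸i]≡n∸i)))
        (has-degree w w∈V)
    degree-S─A : ∀ w → InComp r w → side w ≡ false → HasDegree w (n ∸ k + i)
    degree-S─A w w∈@(w∈V , _) _ with trace w ≟ⱽ A
    ... | no w≢A with class w w∈
    ...   | inj₁ p = ⊥-elim (w≢A p)
    ...   | inj₂ p = subst (HasDegree w)
        (trans (degree w w∈V) (cong ((n ∸ k) +_)
          (trans (cong ∣_∣ p) (trans (∣S─∣ A A⊑S) (trans (cong (k ∸_) ∣A∣) (m∸[m∸n]≡n i≤k))))))
        (has-degree w w∈V)

  P⇐ : ∀ r → Vx r → ∣ trace r ∣ ≡ k ∸ i ⊎ ∣ trace r ∣ ≡ i → P r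
  P⇐ r r∈V (inj₁ ∣t∣) = class⇒P r (trace r) (trace-⊑ r) ∣t∣ (λ w (_ , walk) → component-TraceIn r w walk)
  P⇐ r r∈V (inj₂ ∣t∣) =
    class⇒P r (S ─ trace r) (─-⊑ (trace r)) (trans (∣S─∣ (trace r) (trace-⊑ r)) (cong (k ∸_) ∣t∣))
      (λ w (_ , walk) → TraceIn-─ (trace r) (trace-⊑ r) w (component-TraceIn r w walk))

  P⇒ : ∀ r → Vx r → P r → ∣ trace r ∣ ≡ k ∸ i ⊎ ∣ trace r ∣ ≡ i
  P⇒ r r∈V (side , _ , degree-true , degree-false) with side r in side-r
  ... | true = inj₁ (+-cancelˡ-≡ (n ∸ k) _ _ (begin
    (n ∸ k) + ∣ trace r ∣  ≡⟨ sym (degree r r∈V) ⟩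
    ∣ free r ∣             ≡⟨ sym (degree-unique r _ r∈V (degree-true r (r∈V , ε) side-r)) ⟩
    n ∸ i                  ≡⟨ sym n∸k+[k∸i]≡n∸i ⟩
    (n ∸ k) + (k ∸ i)      ∎))
    where open ≡-Reasoning
  ... | false = inj₂ (+-cancelˡ-≡ (n ∸ k) _ _
    (trans (sym (degree r r∈V)) (sym (degree-unique r _ r∈V (degree-false r (r∈V , ε) side-r)))))

  P⇒class : ∀ r → Vx r → P r → Σ V λ B → B ⊑ S × ∣ B ∣ ≡ i × TraceIn B r
  P⇒class r r∈V Pr with P⇒ r r∈V Pr
  ... | inj₂ ∣t∣ = trace r , trace-⊑ r , ∣t∣ , inj₁ refl
  ... | inj₁ ∣t∣ = S ─ trace r , ─-⊑ (trace r) ,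
                   trans (∣S─∣ (trace r) (trace-⊑ r)) (trans (cong (k ∸_) ∣t∣) (m∸[m∸n]≡n i≤k)) ,
                   inj₂ (sym (─-involutive (trace r) (trace-⊑ r)))

  P-isomorphic : ∀ r₁ r₂ → Vx r₁ → Vx r₂ → P r₁ → P r₂ → IsoComp r₁ r₂
  P-isomorphic r₁ r₂ r₁∈V r₂∈V P₁ P₂
    with B₁ , B₁⊑S , ∣B₁∣ , r₁∈B₁ ← P⇒class r₁ r₁∈V P₁
       | B₂ , B₂⊑S , ∣B₂∣ , r₂∈B₂ ← P⇒class r₂ r₂∈V P₂ =
    classes-isomorphic S≢∅ ∣S∣≤n' B₁ B₂ B₁⊑S B₂⊑S (trans ∣B₁∣ (sym ∣B₂∣)) r₁ r₂ r₁∈V r₂∈V r₁∈B₁ r₂∈B₂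

  -- A repetition-free list of i-subsets of S containing exactly one set of
  -- each complementary pair {B, S ─ B} counts these components: the vertices
  -- with the listed traces represent them, one each.
  count-components : (L : List V) → Unique L →
    (∀ B → B ∈ᴸ L → B ⊑ S × ∣ B ∣ ≡ i) →
    (∀ B B' → B ∈ᴸ L → B' ∈ᴸ L → B' ≢ S ─ B) →
    (∀ B → B ⊑ S → ∣ B ∣ ≡ i → B ∈ᴸ L ⊎ (S ─ B) ∈ᴸ L) →
    ExactlyComps P (length L)
  count-components L L-unique L-sound L-no-pairs L-covers = rep , rep-P , rep-distinct , rep-cover
    where
    trace-of : Fin (length L) → V
    trace-of j = List.lookup L j
    listed : ∀ j → trace-of j ⊑ S × ∣ trace-of j ∣ ≡ i
    listed j = L-sound (trace-of j) (∈-lookup j)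
    representative : ∀ j → Σ V λ u → Vx u × trace u ≡ trace-of j
    representative j = vertex-with-trace (≤-trans ∣S∣≤n' (n≤1+n n')) (trace-of j) (proj₁ (listed j))
      (≤-trans (≤-reflexive (proj₂ (listed j))) (≤-trans i≤k k≤n'))
    rep : Fin (length L) → V
    rep j = proj₁ (representative j)
    rep∈V : ∀ j → Vx (rep j)
    rep∈V j = proj₁ (proj₂ (representative j))
    trace-rep : ∀ j → trace (rep j) ≡ trace-of j
    trace-rep j = proj₂ (proj₂ (representative j))
    rep-P : ∀ j → Vx (rep j) × P (rep j)
    rep-P j = rep∈V j , P⇐ (rep j) (rep∈V j) (inj₂ (trans (cong ∣_∣ (trace-rep j)) (proj₂ (listed j))))
    rep-distinct : ∀ j j' → Star E (rep j) (rep j') → j ≡ j'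
    rep-distinct j j' walk with component-TraceIn (rep j) (rep j') walk
    ... | inj₁ same = lookup-injective L L-unique j j' (trans (sym (trace-rep j)) (trans (sym same) (trace-rep j')))
    ... | inj₂ opposite = ⊥-elim (L-no-pairs (trace-of j) (trace-of j') (∈-lookup j) (∈-lookup j')
                            (trans (sym (trace-rep j')) (trans opposite (cong (S ─_) (trace-rep j)))))
    reach : ∀ B → B ⊑ S → (p : B ∈ᴸ L) → ∀ w → Vx w → TraceIn B w → Star E (rep (index p)) w
    reach B B⊑S p w w∈V w∈B = TraceIn⇒component ∣S∣≤n' B B⊑S (rep (index p)) (rep∈V (index p))
      (inj₁ (trans (trace-rep (index p)) (sym (lookup-index p)))) w w∈V w∈B
    rep-cover : ∀ w → Vx w → P w → ∃ λ j → Star E (rep j) w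
    rep-cover w w∈V Pw with B , B⊑S , ∣B∣ , w∈B ← P⇒class w w∈V Pw with L-covers B B⊑S ∣B∣
    ... | inj₁ p = index p , reach B B⊑S p w w∈V w∈B
    ... | inj₂ p = index p , reach (S ─ B) (─-⊑ B) p w w∈V (TraceIn-─ B B⊑S w w∈B)

  -- Second claim, 2i ≠ k: each pair {B, S ─ B} with ∣ B ∣ = i contains a single
  -- i-set, so the i-subsets of S count the components.
  count-unbalanced : 2 * i ≢ k → ExactlyComps P (k C i)
  count-unbalanced 2i≢k = subst (ExactlyComps P) (trans (length-subsets S i) (cong (_C i) ∣S∣≡k))
    (count-components (subsets S i) (subsets-unique S i) (subsets-sound S i) no-pairs covers)
    where
    no-pairs : ∀ B B' → B ∈ᴸ subsets S i → B' ∈ᴸ subsets S i → B' ≢ S ─ B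
    no-pairs B B' p p' B'≡S─B = 2i≢k (begin
      2 * i           ≡⟨ cong (i +_) (+-identityʳ i) ⟩
      i + i           ≡⟨ cong (i +_) i≡k∸i ⟩
      i + (k ∸ i)     ≡⟨ m+[n∸m]≡n i≤k ⟩
      k               ∎)
      where
      open ≡-Reasoning
      B-listed = subsets-sound S i B p
      i≡k∸i : i ≡ k ∸ i
      i≡k∸i = trans (sym (proj₂ (subsets-sound S i B' p')))
                (trans (cong ∣_∣ B'≡S─B) (trans (∣S─∣ B (proj₁ B-listed)) (cong (k ∸_) (proj₂ B-listed))))
    covers : ∀ B → B ⊑ S → ∣ B ∣ ≡ i → B ∈ᴸ subsets S i ⊎ (S ─ B) ∈ᴸ subsets S i
    covers B B⊑S ∣B∣ = inj₁ (subst (λ j → B ∈ᴸ subsets S j) ∣B∣ (subsets-complete S B B⊑S))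

  -- Second claim, 2i = k: the pairs {B, S ─ B} are named by their member
  -- containing the least element of S.
  count-balanced : 2 * i ≡ k → ∃ λ N → ExactlyComps P N × 2 * N ≡ k C i
  count-balanced 2i≡k =
    length L ,
    count-components L (subsetsWithLeast-unique S i) listed no-pairs covers ,
    trans (subst (λ t → 2 * length (subsetsWithLeast S t) ≡ ∣ S ∣ C t) (sym i≡1+j)
             (length-subsetsWithLeast-half S j (trans ∣S∣≡k (trans (sym 2i≡k) (cong (2 *_) i≡1+j)))))
          (cong (_C i) ∣S∣≡k)
    where
    L = subsetsWithLeast S i
    j = pred i
    i≡1+j : i ≡ suc j
    i≡1+j = sym (suc-pred i {{≢-nonZero λ i≡0 → <-irrefl (trans (sym (cong (2 *_) i≡0)) 2i≡k) 0<k}})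
    k∸i≡i : k ∸ i ≡ i
    k∸i≡i = trans (cong (_∸ i) (trans (sym 2i≡k) (cong (i +_) (+-identityʳ i)))) (m+n∸m≡n i i)
    listed : ∀ B → B ∈ᴸ L → B ⊑ S × ∣ B ∣ ≡ i
    listed B p = let (B⊑S , ∣B∣ , _) = subsetsWithLeast-sound S i B p in B⊑S , ∣B∣
    no-pairs : ∀ B B' → B ∈ᴸ L → B' ∈ᴸ L → B' ≢ S ─ B
    no-pairs B B' p p' B'≡S─B = least-not-in-both S B (proj₂ (proj₂ (subsetsWithLeast-sound S i B p)))
      (subst (ContainsLeast S) B'≡S─B (proj₂ (proj₂ (subsetsWithLeast-sound S i B' p'))))
    covers : ∀ B → B ⊑ S → ∣ B ∣ ≡ i → B ∈ᴸ L ⊎ (S ─ B) ∈ᴸ L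
    covers B B⊑S ∣B∣ with least-in-one S B S≢∅
    ... | inj₁ B∋least = inj₁ (subst (λ t → B ∈ᴸ subsetsWithLeast S t) ∣B∣
                                 (subsetsWithLeast-complete S B B⊑S B∋least))
    ... | inj₂ S─B∋least = inj₂ (subst (λ t → (S ─ B) ∈ᴸ subsetsWithLeast S t) ∣S─B∣
                                   (subsetsWithLeast-complete S (S ─ B) (─-⊑ B) S─B∋least))
      where
      ∣S─B∣ : ∣ S ─ B ∣ ≡ i
      ∣S─B∣ = trans (∣S─∣ B B⊑S) (trans (cong (k ∸_) ∣B∣) k∸i≡i)

mainTheorem4 : (n k : ℕ) (S : Sub n) (i : ℕ) →
    1 ≤ n → 0 < k → k < n → ∣ S ∣ ≡ k → i ≤ k →
    let open Graph (IsVertex n) (AdjOS n S)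
        P = BiregularComp (n ∸ i) (n ∸ k + i)
    in (∀ r₁ r₂ → IsVertex n r₁ → IsVertex n r₂ → P r₁ → P r₂ → IsoComp r₁ r₂)
       × (2 * i ≢ k → ExactlyComps P (k C i))
       × (2 * i ≡ k → ∃ λ N → ExactlyComps P N × 2 * N ≡ k C i)
mainTheorem4 (suc n') k S i _ 0<k (s≤s k≤n') ∣S∣≡k i≤k =
  P-isomorphic , count-unbalanced , count-balanced
  where open BiregularComponents n' k S ∣S∣≡k 0<k k≤n' i i≤k
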